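{- There exists a $(u\times v,g\times h,\{4,5\},1)$-BDP for each $(u,v,g,h)\in\{(2,36,2,4),(2,72,2,8),(2,108,2,12),(4,72,4,8),(6,12,2,4),(6,36,2,12),(12,24,4,8),(18,4,2,4),(18,12,2,12)\}$.
   Context: Let $G$ be a finite additive group and $K$ a set of positive integers. For $C\subseteq G$, $\Delta C$ denotes the multiset of all differences $x-y$ with $(x,y)$ an ordered pair of distinct elements of $C$. A $(G,K,1)$ difference packing is a set $\mathcal B$ of subsets of $G$ (blocks), each of size in $K$, such that the multiset $\bigcup_{B\in\mathcal B}\Delta B$ contains every element of $G$ at most once; its difference leave is the set of elements of $G$ not occurring in this multiset. It is balanced (BDP) if the number of blocks of size $k$ is the same for every $k\in K$. For $s\mid u$ and $t\mid v$, a $(u\times v,s\times t,K,1)$-BDP is a balanced $(Z_u\times Z_v,K,1)$ difference packing whose difference leave is exactly the subgroup $(u/s)Z_u\times (v/t)Z_v$. -}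

module Defs where

open import Data.Nat using (ℕ; _+_; _∸_; _≤_; NonZero)
open import Data.Nat.DivMod using (_%_; _/_; m%n<n)
open import Data.Nat.Divisibility using (_∣_)
open import Data.Fin using (Fin; toℕ; fromℕ<)
import Data.Fin.Properties as FinP
open import Data.Product using (_×_; _,_; Σ)
open import Data.Product.Properties using (≡-dec)
open import Data.List using (List; length; map; filter; concatMap)
open import Data.List.Relation.Unary.All using (All)
open import Data.List.Relation.Unary.Unique.Propositional using (Unique)
open import Data.List.Membership.Propositional using (_∈_; _∉_)
open import Data.Sum using (_⊎_)
open import Relation.Binary.PropositionalEquality using (_≡_)
open import Relation.Nullary using (¬_)
open import Relation.Nullary.Decidable using (¬?)
open import Function.Bundles using (_⇔_)

G : ℕ → ℕ → Set
G u v = Fin u × Fin v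

subZ : ∀ {u} .{{_ : NonZero u}} → Fin u → Fin u → Fin u
subZ {u} x y = fromℕ< (m%n<n (toℕ x + (u ∸ toℕ y)) u)

_⊖_ : ∀ {u v} .{{_ : NonZero u}} .{{_ : NonZero v}} → G u v → G u v → G u v
(a , b) ⊖ (c , d) = subZ a c , subZ b d

_≟G_ : ∀ {u v} (x y : G u v) → Relation.Nullary.Dec (x ≡ y)
_≟G_ = ≡-dec FinP._≟_ FinP._≟_

-- ΔC : all differences x - y over ordered pairs of distinct elements of C
-- (C is a duplicate-free list, so "distinct elements" = "x ≢ y").
Δ : ∀ {u v} .{{_ : NonZero u}} .{{_ : NonZero v}} → List (G u v) → List (G u v)
Δ C = concatMap (λ x → map (λ y → x ⊖ y) (filter (λ y → ¬? (x ≟G y)) C)) C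

ΔAll : ∀ {u v} .{{_ : NonZero u}} .{{_ : NonZero v}} → List (List (G u v)) → List (G u v)
ΔAll = concatMap Δ

numOfSize : ∀ {u v} → ℕ → List (List (G u v)) → ℕ
numOfSize k ℬ = length (filter (λ B → length B Data.Nat.≟ k) ℬ)

InSub : ∀ {u v} (s t : ℕ) .{{_ : NonZero s}} .{{_ : NonZero t}} → G u v → Set
InSub {u} {v} s t (a , b) = ((u / s) ∣ toℕ a) × ((v / t) ∣ toℕ b)

-- A (u×v, s×t, {4,5}, 1)-BDP, given by its list of blocks ℬ:
--  * blocks are sets (no repeated elements), pairwise distinct, of size 4 or 5,
--  * every group element occurs at most once in ⋃ ΔB  (the list ΔAll ℬ is duplicate-free),
--  * balanced: as many blocks of size 4 as of size 5,
--  * difference leave is exactly the subgroup (u/s)Z_u × (v/t)Z_v.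
record IsBDP45 (u v s t : ℕ) .{{_ : NonZero u}} .{{_ : NonZero v}}
               .{{_ : NonZero s}} .{{_ : NonZero t}}
               (ℬ : List (List (G u v))) : Set where
  field
    blocksAreSets : All Unique ℬ
    blocksDistinct : Unique ℬ
    blockSizes : All (λ B → (length B ≡ 4) ⊎ (length B ≡ 5)) ℬ
    packing : Unique (ΔAll ℬ)
    balanced : numOfSize 4 ℬ ≡ numOfSize 5 ℬ
    leave : ∀ (x : G u v) → (x ∉ ΔAll ℬ) ⇔ InSub s t x

BDP45 : (u v s t : ℕ) .{{_ : NonZero u}} .{{_ : NonZero v}}
        .{{_ : NonZero s}} .{{_ : NonZero t}} → Set
BDP45 u v s t = Σ (List (List (G u v))) (IsBDP45 u v s t)

-- Every condition in IsBDP45 is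
-- decidable because the group is finite, so each list is certified by evaluating
-- the decision procedure isBDP45? on it.
module Submission where

open import Defs
open import Agda.Builtin.FromNat using (Number; fromNat)
open import Data.Nat using (ℕ; NonZero; _≟_)
open import Data.Nat.Divisibility using (_∣?_)
open import Data.Fin using (Fin)
import Data.Fin.Literals as FinLiterals
import Data.Nat.Literals as ℕLiterals
import Data.Fin.Properties as Fin
open import Data.Product using (_×_; _,_; uncurry)
open import Data.List using (List; length; _∷_; [])
open import Data.List.Properties using (≡-dec)
open import Data.List.Relation.Unary.All using (all?)
open import Data.List.Relation.Unary.Unique.DecPropositional using (unique?)
-- tt is the instance discharging the (trivial) constraint of overloaded ℕ literals.
open import Data.Unit using (tt)
open import Data.List.Membership.DecPropositional using (_∉?_)
open import Function.Bundles using (_⇔_; mk⇔; module Equivalence)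
open import Relation.Nullary using (Dec)
open import Relation.Nullary.Decidable
  using (True; toWitness; map′; _×-dec_; _⊎-dec_; _→-dec_)
open import Relation.Unary using (Pred; Decidable)

instance
  finLiterals : ∀ {n} → Number (Fin n)
  finLiterals = FinLiterals.number _
  natLiterals : Number ℕ
  natLiterals = ℕLiterals.number

_⇔-dec_ : ∀ {a b} {A : Set a} {B : Set b} → Dec A → Dec B → Dec (A ⇔ B)
a? ⇔-dec b? = map′ (uncurry mk⇔) (λ A⇔B → to A⇔B , from A⇔B)
                   ((a? →-dec b?) ×-dec (b? →-dec a?))
  where open Equivalence

module _ {u v : ℕ} {{_ : NonZero u}} {{_ : NonZero v}} where

  allG? : ∀ {p} {P : Pred (G u v) p} → Decidable P → Dec (∀ x → P x)
  allG? P? = map′ (λ ∀P (a , b) → ∀P a b) (λ ∀P a b → ∀P (a , b))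
                  (Fin.all? λ a → Fin.all? λ b → P? (a , b))

  inSub? : (s t : ℕ) {{_ : NonZero s}} {{_ : NonZero t}} → Decidable (InSub {u} {v} s t)
  inSub? s t (a , b) = (_ ∣? _) ×-dec (_ ∣? _)

  isBDP45? : (s t : ℕ) {{_ : NonZero s}} {{_ : NonZero t}} →
             (ℬ : List (List (G u v))) → Dec (IsBDP45 u v s t ℬ)
  isBDP45? s t ℬ = map′
    (λ (sets , distinct , sizes , pack , bal , lv) → record
      { blocksAreSets = sets ; blocksDistinct = distinct ; blockSizes = sizes
      ; packing = pack ; balanced = bal ; leave = lv })
    (λ bdp → blocksAreSets bdp , blocksDistinct bdp , blockSizes bdp
           , packing bdp , balanced bdp , leave bdp)
    (all? (unique? _≟G_) ℬ
     ×-dec unique? (≡-dec _≟G_) ℬ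
     ×-dec all? (λ B → (length B ≟ 4) ⊎-dec (length B ≟ 5)) ℬ
     ×-dec unique? _≟G_ (ΔAll ℬ)
     ×-dec numOfSize 4 ℬ ≟ numOfSize 5 ℬ
     ×-dec allG? (λ x → _∉?_ _≟G_ x (ΔAll ℬ) ⇔-dec inSub? s t x))
    where open IsBDP45

bdp45 : (u v s t : ℕ) {{_ : NonZero u}} {{_ : NonZero v}} {{_ : NonZero s}} {{_ : NonZero t}}
        (ℬ : List (List (G u v))) {_ : True (isBDP45? s t ℬ)} → BDP45 u v s t
bdp45 u v s t ℬ {certified} = ℬ , toWitness certified

design-2×36 : BDP45 2 36 2 4
design-2×36 = bdp45 2 36 2 4
  ( ((0 , 0) ∷ (0 , 16) ∷ (0 , 12) ∷ (0 , 35) ∷ (1 , 29) ∷ [])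
  ∷ ((0 , 0) ∷ (0 , 25) ∷ (1 , 1) ∷ (0 , 15) ∷ (1 , 4) ∷ [])
  ∷ ((0 , 0) ∷ (0 , 6) ∷ (0 , 14) ∷ (1 , 34) ∷ [])
  ∷ ((0 , 0) ∷ (0 , 2) ∷ (0 , 7) ∷ (1 , 33) ∷ [])
  ∷ [])

design-2×72 : BDP45 2 72 2 8
design-2×72 = bdp45 2 72 2 8
  ( ((0 , 0) ∷ (0 , 55) ∷ (1 , 66) ∷ (0 , 2) ∷ (1 , 4) ∷ [])
  ∷ ((0 , 0) ∷ (1 , 42) ∷ (0 , 61) ∷ (1 , 29) ∷ (0 , 14) ∷ [])
  ∷ ((0 , 0) ∷ (1 , 49) ∷ (1 , 7) ∷ (0 , 29) ∷ (0 , 24) ∷ [])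
  ∷ ((0 , 0) ∷ (0 , 3) ∷ (0 , 23) ∷ (0 , 31) ∷ (1 , 62) ∷ [])
  ∷ ((0 , 0) ∷ (0 , 1) ∷ (0 , 7) ∷ (0 , 57) ∷ [])
  ∷ ((0 , 0) ∷ (0 , 21) ∷ (1 , 24) ∷ (1 , 56) ∷ [])
  ∷ ((0 , 0) ∷ (0 , 12) ∷ (0 , 38) ∷ (1 , 26) ∷ [])
  ∷ ((0 , 0) ∷ (0 , 4) ∷ (0 , 37) ∷ (1 , 71) ∷ [])
  ∷ [])

design-2×108 : BDP45 2 108 2 12
design-2×108 = bdp45 2 108 2 12
  ( ((0 , 0) ∷ (1 , 88) ∷ (0 , 10) ∷ (0 , 38) ∷ (1 , 48) ∷ [])
  ∷ ((0 , 0) ∷ (0 , 16) ∷ (1 , 101) ∷ (0 , 95) ∷ (1 , 40) ∷ [])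
  ∷ ((0 , 0) ∷ (1 , 67) ∷ (0 , 21) ∷ (0 , 88) ∷ (0 , 55) ∷ [])
  ∷ ((0 , 0) ∷ (0 , 1) ∷ (1 , 15) ∷ (1 , 52) ∷ (0 , 57) ∷ [])
  ∷ ((0 , 0) ∷ (1 , 107) ∷ (1 , 64) ∷ (0 , 32) ∷ (1 , 49) ∷ [])
  ∷ ((0 , 0) ∷ (1 , 83) ∷ (1 , 39) ∷ (0 , 4) ∷ (0 , 86) ∷ [])
  ∷ ((0 , 0) ∷ (0 , 2) ∷ (0 , 48) ∷ (1 , 82) ∷ [])
  ∷ ((0 , 0) ∷ (0 , 12) ∷ (1 , 4) ∷ (1 , 43) ∷ [])
  ∷ ((0 , 0) ∷ (0 , 24) ∷ (1 , 2) ∷ (1 , 37) ∷ [])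
  ∷ ((0 , 0) ∷ (0 , 7) ∷ (0 , 30) ∷ (0 , 49) ∷ [])
  ∷ ((0 , 0) ∷ (0 , 3) ∷ (0 , 8) ∷ (1 , 19) ∷ [])
  ∷ ((0 , 0) ∷ (0 , 6) ∷ (0 , 17) ∷ (0 , 31) ∷ [])
  ∷ [])

design-4×72 : BDP45 4 72 4 8
design-4×72 = bdp45 4 72 4 8
  ( ((0 , 0) ∷ (1 , 58) ∷ (1 , 2) ∷ (3 , 60) ∷ (0 , 8) ∷ [])
  ∷ ((0 , 0) ∷ (1 , 29) ∷ (2 , 26) ∷ (1 , 28) ∷ (2 , 60) ∷ [])
  ∷ ((0 , 0) ∷ (2 , 35) ∷ (2 , 52) ∷ (3 , 4) ∷ (0 , 29) ∷ [])
  ∷ ((0 , 0) ∷ (0 , 30) ∷ (2 , 1) ∷ (1 , 14) ∷ (0 , 35) ∷ [])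
  ∷ ((0 , 0) ∷ (2 , 33) ∷ (3 , 67) ∷ (3 , 7) ∷ (3 , 5) ∷ [])
  ∷ ((0 , 0) ∷ (0 , 28) ∷ (0 , 6) ∷ (2 , 47) ∷ (2 , 68) ∷ [])
  ∷ ((0 , 0) ∷ (2 , 15) ∷ (0 , 57) ∷ (0 , 32) ∷ (1 , 8) ∷ [])
  ∷ ((0 , 0) ∷ (2 , 48) ∷ (3 , 69) ∷ (0 , 59) ∷ (1 , 47) ∷ [])
  ∷ ((0 , 0) ∷ (0 , 33) ∷ (1 , 4) ∷ (3 , 17) ∷ [])
  ∷ ((0 , 0) ∷ (0 , 4) ∷ (0 , 24) ∷ (3 , 59) ∷ [])
  ∷ ((0 , 0) ∷ (1 , 6) ∷ (2 , 5) ∷ (3 , 62) ∷ [])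
  ∷ ((0 , 0) ∷ (0 , 14) ∷ (1 , 53) ∷ (2 , 21) ∷ [])
  ∷ ((0 , 0) ∷ (0 , 7) ∷ (0 , 26) ∷ (3 , 37) ∷ [])
  ∷ ((0 , 0) ∷ (0 , 3) ∷ (1 , 22) ∷ (1 , 33) ∷ [])
  ∷ ((0 , 0) ∷ (0 , 23) ∷ (1 , 38) ∷ (3 , 46) ∷ [])
  ∷ ((0 , 0) ∷ (0 , 31) ∷ (1 , 11) ∷ (2 , 3) ∷ [])
  ∷ [])

design-6×12 : BDP45 6 12 2 4
design-6×12 = bdp45 6 12 2 4
  ( ((0 , 0) ∷ (5 , 7) ∷ (5 , 9) ∷ (1 , 10) ∷ (4 , 8) ∷ [])
  ∷ ((0 , 0) ∷ (3 , 1) ∷ (5 , 10) ∷ (1 , 6) ∷ (4 , 10) ∷ [])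
  ∷ ((0 , 0) ∷ (0 , 1) ∷ (0 , 5) ∷ (4 , 7) ∷ [])
  ∷ ((0 , 0) ∷ (1 , 4) ∷ (2 , 0) ∷ (5 , 5) ∷ [])
  ∷ [])

design-6×36 : BDP45 6 36 2 12
design-6×36 = bdp45 6 36 2 12
  ( ((0 , 0) ∷ (2 , 30) ∷ (3 , 10) ∷ (3 , 8) ∷ (4 , 2) ∷ [])
  ∷ ((0 , 0) ∷ (1 , 18) ∷ (1 , 2) ∷ (5 , 35) ∷ (5 , 13) ∷ [])
  ∷ ((0 , 0) ∷ (1 , 34) ∷ (5 , 17) ∷ (0 , 1) ∷ (4 , 27) ∷ [])
  ∷ ((0 , 0) ∷ (2 , 2) ∷ (2 , 12) ∷ (4 , 8) ∷ (1 , 31) ∷ [])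
  ∷ ((0 , 0) ∷ (2 , 35) ∷ (0 , 31) ∷ (1 , 22) ∷ (5 , 31) ∷ [])
  ∷ ((0 , 0) ∷ (0 , 7) ∷ (3 , 5) ∷ (4 , 14) ∷ (1 , 15) ∷ [])
  ∷ ((0 , 0) ∷ (0 , 8) ∷ (1 , 29) ∷ (4 , 13) ∷ [])
  ∷ ((0 , 0) ∷ (0 , 11) ∷ (1 , 35) ∷ (2 , 11) ∷ [])
  ∷ ((0 , 0) ∷ (1 , 25) ∷ (2 , 21) ∷ (4 , 3) ∷ [])
  ∷ ((0 , 0) ∷ (0 , 4) ∷ (0 , 17) ∷ (4 , 16) ∷ [])
  ∷ ((0 , 0) ∷ (1 , 3) ∷ (2 , 13) ∷ (3 , 19) ∷ [])
  ∷ ((0 , 0) ∷ (1 , 4) ∷ (2 , 15) ∷ (4 , 29) ∷ [])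
  ∷ [])

design-12×24 : BDP45 12 24 4 8
design-12×24 = bdp45 12 24 4 8
  ( ((0 , 0) ∷ (4 , 16) ∷ (8 , 4) ∷ (5 , 3) ∷ (9 , 13) ∷ [])
  ∷ ((0 , 0) ∷ (10 , 10) ∷ (1 , 8) ∷ (10 , 18) ∷ (5 , 12) ∷ [])
  ∷ ((0 , 0) ∷ (0 , 23) ∷ (5 , 7) ∷ (7 , 0) ∷ (11 , 17) ∷ [])
  ∷ ((0 , 0) ∷ (4 , 9) ∷ (1 , 14) ∷ (8 , 22) ∷ (2 , 18) ∷ [])
  ∷ ((0 , 0) ∷ (5 , 18) ∷ (10 , 20) ∷ (3 , 16) ∷ (7 , 15) ∷ [])
  ∷ ((0 , 0) ∷ (9 , 17) ∷ (1 , 23) ∷ (11 , 12) ∷ (0 , 10) ∷ [])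
  ∷ ((0 , 0) ∷ (2 , 20) ∷ (0 , 4) ∷ (8 , 3) ∷ (10 , 1) ∷ [])
  ∷ ((0 , 0) ∷ (10 , 16) ∷ (6 , 11) ∷ (1 , 0) ∷ (10 , 11) ∷ [])
  ∷ ((0 , 0) ∷ (1 , 20) ∷ (4 , 22) ∷ (8 , 6) ∷ [])
  ∷ ((0 , 0) ∷ (0 , 7) ∷ (1 , 1) ∷ (6 , 2) ∷ [])
  ∷ ((0 , 0) ∷ (2 , 5) ∷ (4 , 15) ∷ (9 , 1) ∷ [])
  ∷ ((0 , 0) ∷ (1 , 19) ∷ (3 , 4) ∷ (10 , 23) ∷ [])
  ∷ ((0 , 0) ∷ (1 , 2) ∷ (2 , 12) ∷ (8 , 13) ∷ [])
  ∷ ((0 , 0) ∷ (1 , 3) ∷ (2 , 0) ∷ (10 , 17) ∷ [])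
  ∷ ((0 , 0) ∷ (0 , 2) ∷ (1 , 17) ∷ (7 , 9) ∷ [])
  ∷ ((0 , 0) ∷ (0 , 11) ∷ (1 , 16) ∷ (8 , 21) ∷ [])
  ∷ [])

design-18×4 : BDP45 18 4 2 4
design-18×4 = bdp45 18 4 2 4
  ( ((0 , 0) ∷ (3 , 1) ∷ (1 , 1) ∷ (7 , 1) ∷ (11 , 2) ∷ [])
  ∷ ((0 , 0) ∷ (5 , 0) ∷ (8 , 2) ∷ (3 , 3) ∷ (6 , 3) ∷ [])
  ∷ ((0 , 0) ∷ (1 , 0) ∷ (5 , 2) ∷ (11 , 0) ∷ [])
  ∷ ((0 , 0) ∷ (1 , 2) ∷ (5 , 1) ∷ (7 , 3) ∷ [])
  ∷ [])

design-18×12 : BDP45 18 12 2 12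
design-18×12 = bdp45 18 12 2 12
  ( ((0 , 0) ∷ (11 , 7) ∷ (8 , 10) ∷ (1 , 4) ∷ (15 , 10) ∷ [])
  ∷ ((0 , 0) ∷ (13 , 11) ∷ (2 , 1) ∷ (5 , 7) ∷ (1 , 5) ∷ [])
  ∷ ((0 , 0) ∷ (3 , 3) ∷ (4 , 4) ∷ (11 , 3) ∷ (15 , 1) ∷ [])
  ∷ ((0 , 0) ∷ (4 , 7) ∷ (2 , 0) ∷ (6 , 1) ∷ (14 , 0) ∷ [])
  ∷ ((0 , 0) ∷ (8 , 5) ∷ (6 , 9) ∷ (13 , 7) ∷ (3 , 8) ∷ [])
  ∷ ((0 , 0) ∷ (12 , 9) ∷ (14 , 7) ∷ (10 , 10) ∷ (17 , 5) ∷ [])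
  ∷ ((0 , 0) ∷ (1 , 9) ∷ (3 , 0) ∷ (6 , 7) ∷ [])
  ∷ ((0 , 0) ∷ (1 , 11) ∷ (3 , 4) ∷ (8 , 3) ∷ [])
  ∷ ((0 , 0) ∷ (1 , 0) ∷ (6 , 4) ∷ (8 , 8) ∷ [])
  ∷ ((0 , 0) ∷ (1 , 3) ∷ (2 , 9) ∷ (16 , 10) ∷ [])
  ∷ ((0 , 0) ∷ (1 , 10) ∷ (5 , 6) ∷ (13 , 0) ∷ [])
  ∷ ((0 , 0) ∷ (1 , 2) ∷ (6 , 5) ∷ (12 , 1) ∷ [])
  ∷ [])

lemma4p1 : BDP45 2 36 2 4 × BDP45 2 72 2 8 × BDP45 2 108 2 12
    × BDP45 4 72 4 8 × BDP45 6 12 2 4 × BDP45 6 36 2 12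
    × BDP45 12 24 4 8 × BDP45 18 4 2 4 × BDP45 18 12 2 12
lemma4p1 = design-2×36 , design-2×72 , design-2×108
         , design-4×72 , design-6×12 , design-6×36
         , design-12×24 , design-18×4 , design-18×12
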